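{- Let $k$ be a nonnegative integer. If $S\in\mathsf{APS}^B_{2k+1}\setminus\mathsf{APS}^D_{2k+1}$, then $|S|=k$.
   Context: $[n]=\{1,\dots,n\}$, $\pm[n]=[n]\cup-[n]$. $\mathfrak{S}_n^B$ is the group of bijections $w:\pm[n]\to\pm[n]$ with $w(-i)=-w(i)$, written in one-line notation $w(1)\cdots w(n)$; $\mathfrak{S}_n^D\subseteq\mathfrak{S}_n^B$ consists of those $w$ with $|\{i\in[n]:w(i)<0\}|$ even. A pinnacle of $w$ is a value $w(i)$ with $2\le i\le n-1$ and $w(i-1)<w(i)>w(i+1)$; the pinnacle set of $w$ is the set of its pinnacles. $\mathsf{APS}^B_n$ (resp. $\mathsf{APS}^D_n$) is the set of pinnacle sets of elements of $\mathfrak{S}_n^B$ (resp. $\mathfrak{S}_n^D$). -}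

module Defs where

open import Data.Nat using (ℕ; suc; _+_; _≤_)
open import Data.Nat.Divisibility using (_∣_)
open import Data.Integer using (ℤ; ∣_∣; _<_; _<?_; 0ℤ)
open import Data.Fin using (Fin; toℕ)
open import Data.List using (List; length; filter; allFin)
open import Data.List.Membership.Propositional using (_∈_)
open import Data.List.Relation.Unary.Unique.Propositional using (Unique)
open import Data.Product using (Σ; _×_; ∃; ∃-syntax)
open import Function.Bundles using (_⇔_)
open import Relation.Binary.PropositionalEquality using (_≡_)

-- A signed permutation w ∈ 𝔖ᴮ_n, given by its one-line notation
-- w(1) ⋯ w(n) (positions 0-indexed via Fin n).  The one-line word
-- determines the bijection of ±[n] via w(-i) = -w(i); it is a valid
-- such bijection iff every entry lies in ±[n] and the absolute values
-- of the entries are pairwise distinct.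
record SignedPerm (n : ℕ) : Set where
  field
    word      : Fin n → ℤ
    abs-range : ∀ i → 1 ≤ ∣ word i ∣ × ∣ word i ∣ ≤ n
    abs-inj   : ∀ i j → ∣ word i ∣ ≡ ∣ word j ∣ → i ≡ j
open SignedPerm public

negCount : ∀ {n} → SignedPerm n → ℕ
negCount {n} w = length (filter (λ i → word w i <? 0ℤ) (allFin n))

IsTypeD : ∀ {n} → SignedPerm n → Set
IsTypeD w = 2 ∣ negCount w

IsPinnacle : ∀ {n} → SignedPerm n → ℤ → Set
IsPinnacle {n} w x =
  ∃[ h ] ∃[ i ] ∃[ j ]
    (toℕ h + 1 ≡ toℕ i) × (toℕ i + 1 ≡ toℕ j) ×
    (word w i ≡ x) × (word w h < word w i) × (word w j < word w i)

-- S (a duplicate-free list, viewed as a finite set) is the pinnacle set of w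
IsPinnacleSetOf : ∀ {n} → List ℤ → SignedPerm n → Set
IsPinnacleSetOf S w = Unique S × (∀ x → (x ∈ S) ⇔ IsPinnacle w x)

InAPSB : ℕ → List ℤ → Set
InAPSB n S = Σ (SignedPerm n) λ w → IsPinnacleSetOf S w

InAPSD : ℕ → List ℤ → Set
InAPSD n S = Σ (SignedPerm n) λ w → IsTypeD w × IsPinnacleSetOf S w

{-# OPTIONS --safe #-}
-- Let L be the one-line word of w ∈ 𝔖ᴮ_{2k+1}. If L alternates low, high, low, …,
-- high, low, its pinnacles are exactly its k letters in even positions. Otherwise
-- either the second letter or two adjacent letters after the first are not
-- pinnacles, and then some letter t can be deleted without changing the pinnacle
-- set: the first letter, a letter lying strictly between its two neighbours, or a
-- last letter above its predecessor. The letter −t can be put back without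
-- changing the pinnacle set either, between two neighbours it separates in value
-- or right before a valley (found by walking down a descent). This flips the sign
-- of exactly one letter, so when w ∉ 𝔖ᴰ the new word is in 𝔖ᴰ, with pinnacle set S.
module Submission where

open import Defs
open import Data.Nat using (ℕ; _+_; _*_)
open import Data.List using (List; length)
open import Data.Integer using (ℤ)
open import Relation.Nullary using (¬_)
open import Relation.Binary.PropositionalEquality using (_≡_)

open import Data.Nat using (zero; suc; _≤_)
import Data.Nat.Properties as ℕ
open import Data.Nat.Divisibility using (_∣_; divides; ∣-refl; ∣m∣n⇒∣m+n)
open import Data.Integer using (_<_; _<?_; 0ℤ; -_; +0; +[1+_]; -[1+_]; ∣_∣)
import Data.Integer.Properties as ℤ
open import Data.Fin using (Fin; zero; suc; toℕ)
open import Data.List using ([]; _∷_; [_]; _++_; map; filter; head; lookup; tabulate; allFin)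
open import Data.List.Properties using (++-assoc; length-map; length-tabulate; map-tabulate; tabulate-lookup)
open import Data.List.Membership.Propositional using (_∈_; _∉_)
open import Data.List.Membership.Propositional.Properties using (∈-map⁺; ∈-lookup)
open import Data.List.Membership.Propositional.Properties.WithK using (unique∧set⇒bag)
open import Data.List.Relation.Unary.Any using (here; there)
open import Data.List.Relation.Unary.All as All using (All; []; _∷_)
import Data.List.Relation.Unary.All.Properties as Allₚ
open import Data.List.Relation.Unary.AllPairs using ([]; _∷_)
open import Data.List.Relation.Unary.Unique.Propositional using (Unique)
import Data.List.Relation.Unary.Unique.Propositional.Properties as Uniqueₚ
open import Data.List.Relation.Binary.BagAndSetEquality using (∼bag⇒↭)
open import Data.List.Relation.Binary.Permutation.Propositional
  using (_↭_; ↭⇒↭ₛ; module PermutationReasoning)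
open import Data.List.Relation.Binary.Permutation.Propositional.Properties
  using (↭-length; shift; filter-↭; All-resp-↭; map⁺)
open import Data.List.Relation.Binary.Permutation.Setoid.Properties
  using (Unique-resp-↭)
open import Data.Product using (Σ-syntax; ∃; ∃-syntax; _×_; _,_; proj₁; proj₂)
open import Data.Sum using (_⊎_; inj₁; inj₂)
import Data.Sum as Sum
open import Data.Empty using (⊥; ⊥-elim)
open import Data.Bool using (true; false)
open import Function using (_∘_; id)
open import Function.Bundles using (_⇔_; mk⇔; Equivalence)
open import Relation.Nullary using (Dec; yes; no; does)
open import Relation.Unary using (Decidable; _⊆_; _≐_)
open import Relation.Unary.Properties using (≐-refl; ≐-sym; ≐-trans)
open import Relation.Binary using (tri<; tri≈; tri>)
open import Relation.Binary.PropositionalEquality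
  using (_≢_; refl; sym; trans; cong; cong₂; subst; subst₂; setoid; module ≡-Reasoning)

private variable
  a b c m t u v x y : ℤ
  l r r′ A B C D L L′ S : List ℤ
  n : ℕ

-- Pinnacles of a word

data PeakAfter (a : ℤ) : List ℤ → ℤ → Set where
  peak : a < x → b < x → PeakAfter a (x ∷ b ∷ l) x

data Pinnacle : List ℤ → ℤ → Set where
  second : PeakAfter a l x → Pinnacle (a ∷ l) x
  later  : Pinnacle l x → Pinnacle (a ∷ l) x

SamePinnacles : List ℤ → List ℤ → Set
SamePinnacles L L′ = Pinnacle L ≐ Pinnacle L′

peakAfter? : ∀ a x l → Dec (PeakAfter a (x ∷ l) x)
peakAfter? a x [] = no λ ()
peakAfter? a x (b ∷ l) with a <? x | b <? x
... | yes a<x | yes b<x = yes (peak a<x b<x)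
... | no a≮x  | _       = no λ { (peak a<x _) → a≮x a<x }
... | _       | no b≮x  = no λ { (peak _ b<x) → b≮x b<x }

pinnacle-∈ : Pinnacle l x → x ∈ l
pinnacle-∈ (second (peak _ _)) = there (here refl)
pinnacle-∈ (later p)           = there (pinnacle-∈ p)

Interchangeable : List ℤ → List ℤ → Set
Interchangeable r r′ = ∀ pre → SamePinnacles (pre ++ r) (pre ++ r′)

head-++ : ∀ {A : Set} {r r′ : List A} → head r ≡ head r′ →
          ∀ pre → head (pre ++ r) ≡ head (pre ++ r′)
head-++ eq []      = eq
head-++ _  (_ ∷ _) = refl

peakAfter-head : head r ≡ head r′ → PeakAfter a (x ∷ r) ⊆ PeakAfter a (x ∷ r′)
peakAfter-head {r′ = _ ∷ _} refl (peak a<x b<x) = peak a<x b<x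

pinnacle-++⁺ : head r ≡ head r′ → (∀ {a} → PeakAfter a r ⊆ PeakAfter a r′) →
               Pinnacle r ⊆ Pinnacle r′ → ∀ pre → Pinnacle (pre ++ r) ⊆ Pinnacle (pre ++ r′)
pinnacle-++⁺ _ _     pin⊆ []            p          = pin⊆ p
pinnacle-++⁺ _ peak⊆ _    (_ ∷ [])      (second p) = second (peak⊆ p)
pinnacle-++⁺ h _     _    (_ ∷ _ ∷ pre) (second p) = second (peakAfter-head (head-++ h pre) p)
pinnacle-++⁺ h peak⊆ pin⊆ (_ ∷ pre)     (later p)  = later (pinnacle-++⁺ h peak⊆ pin⊆ pre p)

-- Across the junction with a prefix, the last prefix letter sees only the first
-- letter of r, and the first letter of r sees only the last prefix letter.
interchangeable : head r ≡ head r′ → (∀ {a} → PeakAfter a r ≐ PeakAfter a r′) →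
                  SamePinnacles r r′ → Interchangeable r r′
interchangeable h peak≐ pin≐ pre =
    pinnacle-++⁺ h (proj₁ peak≐) (proj₁ pin≐) pre
  , pinnacle-++⁺ (sym h) (proj₂ peak≐) (proj₂ pin≐) pre

interchangeable-sym : Interchangeable r r′ → Interchangeable r′ r
interchangeable-sym i pre = ≐-sym (i pre)

interchangeable-∷ : Interchangeable r r′ → Interchangeable (a ∷ r) (a ∷ r′)
interchangeable-∷ {r} {r′} {a} i pre =
  subst₂ SamePinnacles (++-assoc pre [ a ] r) (++-assoc pre [ a ] r′) (i (pre ++ [ a ]))

-- Local moves that preserve the pinnacle set

Between : ℤ → ℤ → ℤ → Set
Between a v b = (a < v × v < b) ⊎ (b < v × v < a)

between-sym : Between a v b → Between b v a
between-sym = Sum.swap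

between-< : Between a v b → (v < a) ⇔ (b < a)
between-< (inj₁ (a<v , v<b)) =
  mk⇔ (λ v<a → ⊥-elim (ℤ.<-asym a<v v<a)) (λ b<a → ⊥-elim (ℤ.<-asym b<a (ℤ.<-trans a<v v<b)))
between-< (inj₂ (b<v , v<a)) = mk⇔ (ℤ.<-trans b<v) (λ _ → v<a)

between-not-peak : Between a v b → a < v → b < v → ⊥
between-not-peak (inj₁ (_ , v<b)) _   b<v = ℤ.<-asym v<b b<v
between-not-peak (inj₂ (_ , v<a)) a<v _   = ℤ.<-asym a<v v<a

insert-between : Between a v b → Interchangeable (a ∷ b ∷ r) (a ∷ v ∷ b ∷ r)
insert-between {a} {v} {b} bw = interchangeable refl (peak⊆ , peak⊇) (pin⊆ , pin⊇)
  where
  open Equivalence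
  peak⊆ : PeakAfter c (a ∷ b ∷ r) ⊆ PeakAfter c (a ∷ v ∷ b ∷ r)
  peak⊆ (peak c<a b<a) = peak c<a (from (between-< bw) b<a)
  peak⊇ : PeakAfter c (a ∷ v ∷ b ∷ r) ⊆ PeakAfter c (a ∷ b ∷ r)
  peak⊇ (peak c<a v<a) = peak c<a (to (between-< bw) v<a)
  pin⊆ : Pinnacle (a ∷ b ∷ r) ⊆ Pinnacle (a ∷ v ∷ b ∷ r)
  pin⊆ (second (peak a<b c<b)) = later (second (peak (from (between-< (between-sym bw)) a<b) c<b))
  pin⊆ (later p)               = later (later p)
  pin⊇ : Pinnacle (a ∷ v ∷ b ∷ r) ⊆ Pinnacle (a ∷ b ∷ r)
  pin⊇ (second (peak a<v b<v))         = ⊥-elim (between-not-peak bw a<v b<v)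
  pin⊇ (later (second (peak v<b c<b))) = second (peak (to (between-< (between-sym bw)) v<b) c<b)
  pin⊇ (later (later p))               = later p

insert-before-valley : v < m → m < c → ¬ PeakAfter v (m ∷ r) m →
                       Interchangeable (c ∷ m ∷ r) (c ∷ v ∷ m ∷ r)
insert-before-valley {v} {m} {c} v<m m<c m-low =
  interchangeable refl (peak⊆ , peak⊇) (pin⊆ , pin⊇ m-low)
  where
  peak⊆ : PeakAfter a (c ∷ m ∷ r) ⊆ PeakAfter a (c ∷ v ∷ m ∷ r)
  peak⊆ (peak a<c _) = peak a<c (ℤ.<-trans v<m m<c)
  peak⊇ : PeakAfter a (c ∷ v ∷ m ∷ r) ⊆ PeakAfter a (c ∷ m ∷ r)
  peak⊇ (peak a<c _) = peak a<c m<c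
  pin⊆ : Pinnacle (c ∷ m ∷ r) ⊆ Pinnacle (c ∷ v ∷ m ∷ r)
  pin⊆ (second (peak c<m _)) = ⊥-elim (ℤ.<-asym c<m m<c)
  pin⊆ (later p)             = later (later p)
  pin⊇ : ¬ PeakAfter v (m ∷ r) m → Pinnacle (c ∷ v ∷ m ∷ r) ⊆ Pinnacle (c ∷ m ∷ r)
  pin⊇ _     (second (peak c<v _))         = ⊥-elim (ℤ.<-asym c<v (ℤ.<-trans v<m m<c))
  pin⊇ m-low (later (second p@(peak _ _))) = ⊥-elim (m-low p)
  pin⊇ _     (later (later p))             = later p

drop-last : x < y → Interchangeable (x ∷ y ∷ []) (x ∷ [])
drop-last x<y = interchangeable refl
  ((λ { (peak _ y<x) → ⊥-elim (ℤ.<-asym x<y y<x) }) , λ ())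
  ((λ { (second ()) ; (later (second ())) ; (later (later ())) }) , λ { (second ()) ; (later ()) })

drop-head : ¬ PeakAfter t (x ∷ l) x → SamePinnacles (t ∷ x ∷ l) (x ∷ l)
drop-head x-low = (λ { (second p@(peak _ _)) → ⊥-elim (x-low p) ; (later p) → p }) , later

-- Alternating words, and deletable letters in all others

data Alternating : List ℤ → List ℤ → Set where
  single  : ∀ a → Alternating [ a ] []
  up-down : a < x → b < x → Alternating (b ∷ l) C → Alternating (a ∷ x ∷ b ∷ l) (x ∷ C)

alternating-length : Alternating L C → length L ≡ 2 * length C + 1
alternating-length (single _) = refl
alternating-length (up-down {C = C} _ _ alt) =
  trans (cong (λ (k : ℕ) → suc (suc k)) (alternating-length alt)) (cong (_+ 1) (sym (ℕ.*-suc 2 (length C))))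

alternating-pinnacles : Alternating L C → Pinnacle L ≐ (_∈ C)
alternating-pinnacles (single _) = (λ { (second ()) ; (later ()) }) , λ ()
alternating-pinnacles (up-down a<x b<x alt) =
  (λ { (second (peak _ _))           → here refl
     ; (later (second (peak x<b _))) → ⊥-elim (ℤ.<-asym x<b b<x)
     ; (later (later p))             → there (proj₁ (alternating-pinnacles alt) p) })
  , λ { (here refl)  → second (peak a<x b<x)
      ; (there z∈C) → later (later (proj₂ (alternating-pinnacles alt) z∈C)) }

alternating-unique : Unique L → Alternating L C → Unique C
alternating-unique _              (single _)        = []
alternating-unique (_ ∷ x≢ ∷ u) (up-down _ _ alt) =
  All.tabulate (λ z∈C → All.lookup x≢ (pinnacle-∈ (proj₂ (alternating-pinnacles alt) z∈C)))
  ∷ alternating-unique u alt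

data AdjacentNonPinnacles : List ℤ → Set where
  adjacent : ¬ PeakAfter u (x ∷ y ∷ l) x → ¬ PeakAfter x (y ∷ l) y →
             AdjacentNonPinnacles (u ∷ x ∷ y ∷ l)
  skip     : AdjacentNonPinnacles l → AdjacentNonPinnacles (a ∷ l)

data Defect : List ℤ → Set where
  start : ¬ PeakAfter x (y ∷ l) y → Defect (x ∷ y ∷ l)
  inner : AdjacentNonPinnacles L → Defect L

defect-after : b < x → Defect (b ∷ l) → AdjacentNonPinnacles (x ∷ b ∷ l)
defect-after b<x (start y-low) = adjacent (λ { (peak x<b _) → ℤ.<-asym x<b b<x }) y-low
defect-after _   (inner adj)   = skip adj

alternating-or-defective : ∀ a l → ∃ (Alternating (a ∷ l)) ⊎ Defect (a ∷ l)
alternating-or-defective a []      = inj₁ (_ , single a)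
alternating-or-defective a (x ∷ []) = inj₂ (start λ ())
alternating-or-defective a (x ∷ b ∷ l) with peakAfter? a x (b ∷ l)
... | no x-low = inj₂ (start x-low)
... | yes (peak a<x b<x) with alternating-or-defective b l
...   | inj₁ (C , alt) = inj₁ (x ∷ C , up-down a<x b<x alt)
...   | inj₂ d         = inj₂ (inner (skip (defect-after b<x d)))

Deletable : (List ℤ → List ℤ → Set) → List ℤ → Set
Deletable _~_ L = ∃[ A ] ∃[ t ] ∃[ B ] L ≡ A ++ t ∷ B × L ~ (A ++ B)

≮∧≢⇒> : ¬ a < b → a ≢ b → b < a
≮∧≢⇒> a≮b a≢b = ℤ.≤∧≢⇒< (ℤ.≮⇒≥ a≮b) (a≢b ∘ sym)

adjacent-deletable : Unique L → AdjacentNonPinnacles L → Deletable Interchangeable L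
adjacent-deletable (u≢ ∷ x≢ ∷ _) (adjacent {u = u} {x = x} {y = y} {l = l} x-low _)
  with ℤ.<-cmp x y
... | tri> _ _ y<x = [ u ] , x , y ∷ l , refl , interchangeable-sym (insert-between (inj₂ (y<x , x<u)))
  where
  x<u : x < u
  x<u = ≮∧≢⇒> (λ u<x → x-low (peak u<x y<x)) (All.head u≢)
... | tri≈ _ x≡y _ = ⊥-elim (All.head x≢ x≡y)
adjacent-deletable _ (adjacent {u = u} {x = x} {y = y} {l = []} _ _) | tri< x<y _ _ =
  u ∷ x ∷ [] , y , [] , refl , interchangeable-∷ (drop-last x<y)
adjacent-deletable (_ ∷ _ ∷ y≢ ∷ _) (adjacent {u = u} {x = x} {y = y} {l = z ∷ l} _ y-low)
  | tri< x<y _ _ =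
  u ∷ x ∷ [] , y , z ∷ l , refl ,
  interchangeable-∷ (interchangeable-sym (insert-between (inj₁ (x<y , y<z))))
  where
  y<z : y < z
  y<z = ≮∧≢⇒> (λ z<y → y-low (peak x<y z<y)) (All.head y≢ ∘ sym)
adjacent-deletable (_ ∷ u) (skip {a = a} adj) with adjacent-deletable u adj
... | A , t , B , refl , i = a ∷ A , t , B , refl , interchangeable-∷ i

defect-deletable : Unique L → Defect L → Deletable SamePinnacles L
defect-deletable _ (start {x = x} {y = y} {l = l} y-low) = [] , x , y ∷ l , refl , drop-head y-low
defect-deletable u (inner adj) with adjacent-deletable u adj
... | A , t , B , eq , i = A , t , B , eq , i []

Insertable : ℤ → List ℤ → Set
Insertable v M = ∃[ C ] ∃[ D ] M ≡ C ++ D × SamePinnacles (C ++ v ∷ D) M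

insertable-after-descent : ∀ c a r → a < c → v < c → v ∉ a ∷ r →
  ∃[ C ] ∃[ D ] a ∷ r ≡ C ++ D × Interchangeable (c ∷ a ∷ r) (c ∷ C ++ v ∷ D)
insertable-after-descent {v} c a r a<c v<c v∉ with ℤ.<-cmp a v
... | tri< a<v _ _ = [] , a ∷ r , refl , insert-between (inj₂ (a<v , v<c))
... | tri≈ _ a≡v _ = ⊥-elim (v∉ (here (sym a≡v)))
... | tri> _ _ v<a with peakAfter? v a r
...   | no a-low = [] , a ∷ r , refl , insert-before-valley v<a a<c a-low
...   | yes (peak _ b<a) with insertable-after-descent a _ _ b<a v<a (v∉ ∘ there)
...     | C , D , eq , i = a ∷ C , D , cong (a ∷_) eq , interchangeable-∷ i

insertable : ∀ v M → v ∉ M → Insertable v M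
insertable v []      _  = [] , [] , refl , (λ { (second ()) ; (later ()) }) , λ ()
insertable v (a ∷ r) v∉ with peakAfter? v a r
... | no a-low = [] , a ∷ r , refl , drop-head a-low
... | yes (peak v<a b<a) with insertable-after-descent a _ _ b<a v<a (v∉ ∘ there)
...   | C , D , eq , i = a ∷ C , D , cong (a ∷_) eq , ≐-sym (i [])

-- Flipping one sign in a signed word

record IsSignedWord (n : ℕ) (L : List ℤ) : Set where
  field
    length≡    : length L ≡ n
    in-range   : All (λ k → 1 ≤ k × k ≤ n) (map ∣_∣ L)
    abs-unique : Unique (map ∣_∣ L)
open IsSignedWord

isSignedWord-resp : map ∣_∣ L ↭ map ∣_∣ L′ → IsSignedWord n L → IsSignedWord n L′
isSignedWord-resp {L} {L′} {n} σ w = record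
  { length≡    = begin
      length L′           ≡⟨ length-map ∣_∣ L′ ⟨
      length (map ∣_∣ L′) ≡⟨ ↭-length σ ⟨
      length (map ∣_∣ L)  ≡⟨ length-map ∣_∣ L ⟩
      length L            ≡⟨ length≡ w ⟩
      n                   ∎
  ; in-range   = All-resp-↭ σ (in-range w)
  ; abs-unique = Unique-resp-↭ (setoid ℕ) (↭⇒↭ₛ σ) (abs-unique w)
  }
  where open ≡-Reasoning

abs-shift : map ∣_∣ (A ++ t ∷ B) ↭ ∣ t ∣ ∷ map ∣_∣ (A ++ B)
abs-shift {A} {t} {B} = map⁺ ∣_∣ (shift t A B)

negated-fresh : Unique (map ∣_∣ (A ++ t ∷ B)) → - t ∉ A ++ B
negated-fresh {A} {t} {B} u -t∈AB with Unique-resp-↭ (setoid ℕ) (↭⇒↭ₛ (abs-shift {A})) u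
... | t≢ ∷ _ = All.lookup t≢ (∈-map⁺ ∣_∣ -t∈AB) (sym (ℤ.∣-i∣≡∣i∣ t))

negatives : List ℤ → ℕ
negatives L = length (filter (_<? 0ℤ) L)

negatives-↭ : L ↭ L′ → negatives L ≡ negatives L′
negatives-↭ σ = ↭-length (filter-↭ (_<? 0ℤ) σ)

2∣-or-2∣suc : ∀ n → (2 ∣ n) ⊎ (2 ∣ suc n)
2∣-or-2∣suc zero = inj₁ (divides 0 refl)
2∣-or-2∣suc (suc n) with 2∣-or-2∣suc n
... | inj₁ 2∣n  = inj₂ (∣m∣n⇒∣m+n ∣-refl 2∣n)
... | inj₂ 2∣1+n = inj₁ 2∣1+n

-- negatives (t ∷ M) computes to negatives M or suc (negatives M) by the sign of t.
negatives-negate : ∀ t M → 1 ≤ ∣ t ∣ → ¬ 2 ∣ negatives (t ∷ M) → 2 ∣ negatives (- t ∷ M)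
negatives-negate +0       _ ()  _
negatives-negate +[1+ _ ] M _ odd with 2∣-or-2∣suc (negatives M)
... | inj₁ even = ⊥-elim (odd even)
... | inj₂ even = even
negatives-negate -[1+ _ ] M _ odd with 2∣-or-2∣suc (negatives M)
... | inj₁ even = even
... | inj₂ even = ⊥-elim (odd even)

EvenTwin : ℕ → List ℤ → Set
EvenTwin n L = ∃[ L′ ] IsSignedWord n L′ × (2 ∣ negatives L′) × SamePinnacles L L′

deletable⇒evenTwin : IsSignedWord n L → ¬ 2 ∣ negatives L → Deletable SamePinnacles L → EvenTwin n L
deletable⇒evenTwin w odd (A , t , B , refl , L≈AB)
  with insertable (- t) (A ++ B) (negated-fresh {A} (abs-unique w))
... | C , D , AB≡CD , L′≈AB =
  C ++ - t ∷ D , isSignedWord-resp abs↭ w , even , ≐-trans L≈AB (≐-sym L′≈AB)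
  where
  abs↭ : map ∣_∣ (A ++ t ∷ B) ↭ map ∣_∣ (C ++ - t ∷ D)
  abs↭ = begin
    map ∣_∣ (A ++ t ∷ B)       ↭⟨ abs-shift {A} ⟩
    ∣ t ∣ ∷ map ∣_∣ (A ++ B)   ≡⟨ cong₂ _∷_ (sym (ℤ.∣-i∣≡∣i∣ t)) (cong (map ∣_∣) AB≡CD) ⟩
    ∣ - t ∣ ∷ map ∣_∣ (C ++ D) ↭⟨ abs-shift {C} ⟨
    map ∣_∣ (C ++ - t ∷ D)     ∎
    where open PermutationReasoning
  t-range : 1 ≤ ∣ t ∣
  t-range = proj₁ (All.head (All-resp-↭ (abs-shift {A}) (in-range w)))
  odd′ : ¬ 2 ∣ negatives (t ∷ A ++ B)
  odd′ = odd ∘ subst (2 ∣_) (sym (negatives-↭ (shift t A B)))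
  negatives-L′ : negatives (C ++ - t ∷ D) ≡ negatives (- t ∷ A ++ B)
  negatives-L′ = trans (negatives-↭ (shift (- t) C D)) (cong (λ M → negatives (- t ∷ M)) (sym AB≡CD))
  even : 2 ∣ negatives (C ++ - t ∷ D)
  even = subst (2 ∣_) (sym negatives-L′) (negatives-negate t (A ++ B) t-range odd′)

alternating-or-evenTwin : n ≢ 0 → IsSignedWord n L → ¬ 2 ∣ negatives L →
                          ∃ (Alternating L) ⊎ EvenTwin n L
alternating-or-evenTwin {L = []}    n≢0 w _   = ⊥-elim (n≢0 (sym (length≡ w)))
alternating-or-evenTwin {L = a ∷ l} _   w odd with alternating-or-defective a l
... | inj₁ alt = inj₁ alt
... | inj₂ d   = inj₂ (deletable⇒evenTwin w odd (defect-deletable (Uniqueₚ.map⁻ (abs-unique w)) d))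

-- Signed permutations as words

-- IsPinnacle w is FinPinnacle (word w) by definition; abstracting over the
-- word allows induction on n.
FinPinnacle : (Fin n → ℤ) → ℤ → Set
FinPinnacle f x = ∃[ h ] ∃[ i ] ∃[ j ]
  (toℕ h + 1 ≡ toℕ i) × (toℕ i + 1 ≡ toℕ j) × (f i ≡ x) × (f h < f i) × (f j < f i)

finPinnacle⇒pinnacle : (f : Fin n → ℤ) → FinPinnacle f ⊆ Pinnacle (tabulate f)
finPinnacle⇒pinnacle f (zero , zero , _ , () , _)
finPinnacle⇒pinnacle f (zero , suc zero , zero , refl , () , _)
finPinnacle⇒pinnacle f (zero , suc zero , suc zero , refl , () , _)
finPinnacle⇒pinnacle f (zero , suc zero , suc (suc zero) , refl , refl , refl , p , q) = second (peak p q)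
finPinnacle⇒pinnacle f (zero , suc zero , suc (suc (suc _)) , refl , () , _)
finPinnacle⇒pinnacle f (zero , suc (suc _) , _ , () , _)
finPinnacle⇒pinnacle f (suc _ , zero , _ , () , _)
finPinnacle⇒pinnacle f (suc _ , suc _ , zero , _ , () , _)
finPinnacle⇒pinnacle {suc n} f (suc h , suc i , suc j , e₁ , e₂ , e₃ , p , q) =
  later (finPinnacle⇒pinnacle (f ∘ suc)
           (h , i , j , ℕ.suc-injective e₁ , ℕ.suc-injective e₂ , e₃ , p , q))

pinnacle⇒finPinnacle : (f : Fin n → ℤ) → Pinnacle (tabulate f) ⊆ FinPinnacle f
pinnacle⇒finPinnacle {zero} f ()
pinnacle⇒finPinnacle {suc zero} f (second ())
pinnacle⇒finPinnacle {suc (suc zero)} f (second ())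
pinnacle⇒finPinnacle {suc (suc (suc _))} f (second (peak p q)) =
  zero , suc zero , suc (suc zero) , refl , refl , refl , p , q
pinnacle⇒finPinnacle {suc n} f (later p) with pinnacle⇒finPinnacle (f ∘ suc) p
... | h , i , j , e₁ , e₂ , e₃ , p , q = suc h , suc i , suc j , cong suc e₁ , cong suc e₂ , e₃ , p , q

lookup-injective : ∀ {A B : Set} {f : A → B} (xs : List A) → Unique (map f xs) →
                   ∀ {i j} → f (lookup xs i) ≡ f (lookup xs j) → i ≡ j
lookup-injective (x ∷ xs) _          {zero}  {zero}  _ = refl
lookup-injective (x ∷ xs) (fx≢ ∷ _) {zero}  {suc j} e =
  ⊥-elim (All.lookup (Allₚ.map⁻ fx≢) (∈-lookup j) e)
lookup-injective (x ∷ xs) (fx≢ ∷ _) {suc i} {zero}  e =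
  ⊥-elim (All.lookup (Allₚ.map⁻ fx≢) (∈-lookup i) (sym e))
lookup-injective (x ∷ xs) (_ ∷ u)    {suc i} {suc j} e = cong suc (lookup-injective xs u e)

word-isSignedWord : (w : SignedPerm n) → IsSignedWord n (tabulate (word w))
word-isSignedWord w = record
  { length≡    = length-tabulate (word w)
  ; in-range   = subst (All _) (sym (map-tabulate (word w) ∣_∣)) (Allₚ.tabulate⁺ (abs-range w))
  ; abs-unique = subst Unique (sym (map-tabulate (word w) ∣_∣)) (Uniqueₚ.tabulate⁺ (abs-inj w _ _))
  }

signedPerm-from-word : IsSignedWord n L → Σ[ w ∈ SignedPerm n ] tabulate (word w) ≡ L
signedPerm-from-word {L = L} record { length≡ = refl ; in-range = range ; abs-unique = unique } =
  record { word      = lookup L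
         ; abs-range = λ i → All.lookup (Allₚ.map⁻ range) (∈-lookup i)
         ; abs-inj   = λ i j → lookup-injective L unique }
  , tabulate-lookup L

length-filter-map : ∀ {A B : Set} {P : B → Set} (P? : Decidable P) (f : A → B) xs →
                    length (filter (P? ∘ f) xs) ≡ length (filter P? (map f xs))
length-filter-map P? f [] = refl
length-filter-map P? f (x ∷ xs) with does (P? (f x))
... | true  = cong suc (length-filter-map P? f xs)
... | false = length-filter-map P? f xs

negCount-tabulate : (w : SignedPerm n) → negCount w ≡ negatives (tabulate (word w))
negCount-tabulate {n} w =
  trans (length-filter-map (_<? 0ℤ) (word w) (allFin n)) (cong negatives (map-tabulate id (word w)))

pinnacleSet⇒≐ : (w : SignedPerm n) → IsPinnacleSetOf S w → (_∈ S) ≐ Pinnacle (tabulate (word w))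
pinnacleSet⇒≐ w (_ , S⇔) =
  (λ {x} → finPinnacle⇒pinnacle (word w) ∘ Equivalence.to (S⇔ x)) ,
  (λ {x} → Equivalence.from (S⇔ x) ∘ pinnacle⇒finPinnacle (word w))

≐⇒pinnacleSet : (w : SignedPerm n) → Unique S → (_∈ S) ≐ Pinnacle (tabulate (word w)) →
                IsPinnacleSetOf S w
≐⇒pinnacleSet w u (S⊆ , S⊇) =
  u , λ x → mk⇔ (pinnacle⇒finPinnacle (word w) ∘ S⊆) (S⊇ ∘ finPinnacle⇒pinnacle (word w))

evenTwin⇒InAPSD : (w : SignedPerm n) → IsPinnacleSetOf S w → EvenTwin n (tabulate (word w)) → InAPSD n S
evenTwin⇒InAPSD w S-pins (_ , L′-word , even , same) with signedPerm-from-word L′-word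
... | w′ , refl = w′ , subst (2 ∣_) (sym (negCount-tabulate w′)) even ,
                  ≐⇒pinnacleSet w′ (proj₁ S-pins) (≐-trans (pinnacleSet⇒≐ w S-pins) same)

unique∧≐⇒length≡ : ∀ {A : Set} {xs ys : List A} → Unique xs → Unique ys →
                   (_∈ xs) ≐ (_∈ ys) → length xs ≡ length ys
unique∧≐⇒length≡ u v (xs⊆ys , ys⊆xs) =
  ↭-length (∼bag⇒↭ (unique∧set⇒bag u v (mk⇔ xs⊆ys ys⊆xs)))

lemma4p3 : (k : ℕ) (S : List ℤ) →
    InAPSB (2 * k + 1) S → ¬ InAPSD (2 * k + 1) S → length S ≡ k
lemma4p3 k S (w , S-pins) S∉D
  with alternating-or-evenTwin (ℕ.m+1+n≢0 (2 * k)) (word-isSignedWord w)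
         (λ even → S∉D (evenTwin⇒InAPSD w S-pins (_ , word-isSignedWord w , even , ≐-refl)))
... | inj₂ twin = ⊥-elim (S∉D (evenTwin⇒InAPSD w S-pins twin))
... | inj₁ (C , alt) = begin
  length S ≡⟨ unique∧≐⇒length≡ (proj₁ S-pins) C-unique S≐C ⟩
  length C ≡⟨ ℕ.*-cancelˡ-≡ _ _ 2 (ℕ.+-cancelʳ-≡ 1 _ _ 2C+1≡2k+1) ⟩
  k        ∎
  where
  open ≡-Reasoning
  C-unique : Unique C
  C-unique = alternating-unique (Uniqueₚ.map⁻ (abs-unique (word-isSignedWord w))) alt
  S≐C : (_∈ S) ≐ (_∈ C)
  S≐C = ≐-trans (pinnacleSet⇒≐ w S-pins) (alternating-pinnacles alt)
  2C+1≡2k+1 : 2 * length C + 1 ≡ 2 * k + 1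
  2C+1≡2k+1 = trans (sym (alternating-length alt)) (length≡ (word-isSignedWord w))
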